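{- Let $P$ be a finite bounded poset with $|P|>1$, $r$ a rational with $0\le r<1$, and $A$ a nontrivial antichain in $P$. (i) For any admissible map $\omega$, $$\mathbf{I}_r(P,A;\omega)=\bigcup_{1\le k\le\omega(P)}\Bigl(\bigl(\mathfrak F(\mathsf b_{k-1}(\hat1_P))-\mathfrak F(\mathsf b_k(\hat1_P))\bigr)\cap\mathfrak F(\mathsf b_{\nu(r k)-1}(A))\Bigr)=\bigcup_{1\le k\le\omega(P)}\Bigl(\mathfrak F\bigl(\mathsf b_{k-1}(\hat1_P)\wedge_{\triangledown}\mathsf b_{\nu(rk)-1}(A)\bigr)-\mathfrak F(\mathsf b_k(\hat1_P))\Bigr),$$ where all absolute blockers are taken w.r.t. $\omega$. (ii) If $P$ is graded, then $$\mathbf{I}_r(P,A;\rho)=\bigcup_{k\in[1,\rho(P)]:\ \nu(rk)\le\min_{a\in A}\rho(a)}\Bigl(P^{(k)}\cap\mathfrak F\bigl(\mathsf b_{\nu(rk)-1}(A)\bigr)\Bigr),$$ where the absolute blockers are taken w.r.t. $\rho$.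
   Context: $P$ is a finite poset with least element $\hat0_P$ and greatest element $\hat1_P$, $|P|>1$. For $A\subseteq P$, $\mathfrak I(A)=\{p: p\le a\text{ for some }a\in A\}$, $\mathfrak F(A)=\{p: p\ge a\text{ for some }a\in A\}$; $\min Q$, $\max Q$ denote minimal/maximal elements of $Q\subseteq P$. $\mathfrak{A}_{\vartriangle}(P)$: all antichains (including empty) ordered by $\mathfrak I(A')\subseteq\mathfrak I(A'')$, meet $A'\wedge_{\vartriangle}A''=\max(\mathfrak I(A')\cap\mathfrak I(A''))$. $\mathfrak{A}_{\triangledown}(P)$: all antichains ordered by $\mathfrak F(A')\subseteq\mathfrak F(A'')$, with meet $A'\wedge_{\triangledown}A''=\min(\mathfrak F(A')\cap\mathfrak F(A''))$, least element $\emptyset$, greatest element $\{\hat0_P\}$ (the trivial antichains). Admissible map: $\omega:\mathfrak{A}_{\vartriangle}(P)\to\{ -1\}\cup\mathbb N$ with $\omega(\emptyset)=-1$, $\omega(\{\hat0_P\})=0$, $0<\omega(A')\le\omega(A'')$ whenever $\{\hat0_P\}<A'\le A''$ in $\mathfrak{A}_{\vartriangle}(P)$; $\omega(b):=\omega(\{b\})$, $\omega(P):=\omega(\{\hat1_P\})$. Relatively $r$-blocking elements for a nontrivial antichain $A$: elements $b\in P\setminus\{\hat0_P\}$ with $\omega(\{b\}\wedge_{\vartriangle}\{a\})/\omega(b)>r$ for all $a\in A$; their set is $\mathbf{I}_r(P,A;\omega)$. Absolute $j$-blocker ($0\le j<\omega(P)$, $A$ nontrivial): $\mathsf b_j(A)=\min\{b\in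 P:\omega(\{b\}\wedge_{\vartriangle}\{a\})>j\ \forall a\in A\}$; by convention $\mathsf b_{\omega(P)}(A)=\emptyset$; write $\mathsf b_j(\hat1_P):=\mathsf b_j(\{\hat1_P\})$. For positive integers $k\le\omega(P)$, $\nu(rk):=\lceil rk\rceil$ if $rk\notin\mathbb N$ and $\nu(rk):=rk+1$ if $rk\in\mathbb N$. $[i,j]=\{i,i+1,\dots,j\}$. If $P$ is graded with rank function $\rho$, then $\rho(P):=\rho(\hat1_P)$, $P^{(k)}=\{p\in P:\rho(p)=k\}$, and $\rho$ also denotes the admissible map $\mathfrak{A}_{\vartriangle}(P)\to\{ -1\}\cup\mathbb N$ given by $\rho(\emptyset)=-1$ and $\rho(A)=\max_{a\in A}\rho(a)$ for nonempty antichains $A$. -}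

module Defs where

open import Level using (0ℓ)
open import Data.Nat as ℕ using (ℕ; zero; suc)
open import Data.Integer as ℤ using (ℤ; +_; -1ℤ; 0ℤ; 1ℤ)
open import Data.Rational as ℚ using (ℚ)
open import Data.Bool using (Bool; true; false; _∧_; _∨_; not)
open import Data.Fin using (Fin)
open import Data.Fin.Subset using (Subset; _∈_; _∩_; ⁅_⁆; ⊥)
open import Data.Vec using (Vec; []; _∷_; lookup; tabulate)
open import Data.Product using (Σ; _×_; ∃)
open import Function using (_∘_)
open import Relation.Nullary using (¬_; yes; no)
open import Relation.Nullary.Decidable using (isYes)
open import Relation.Binary using (Rel)
open import Relation.Binary.Structures using (IsDecPartialOrder)
open import Relation.Binary.PropositionalEquality using (_≡_; _≢_)
open import Relation.Unary using (Pred)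

record FinBoundedPoset (n : ℕ) : Set₁ where
  field
    _≤_          : Rel (Fin n) 0ℓ
    isDecPO      : IsDecPartialOrder _≡_ _≤_
    bot          : Fin n
    top          : Fin n
    bot-least    : ∀ p → bot ≤ p
    top-greatest : ∀ p → p ≤ top
  open IsDecPartialOrder isDecPO public using (_≤?_; _≟_)

anyF : ∀ {n} → (Fin n → Bool) → Bool
anyF {zero}  f = false
anyF {suc n} f = f Fin.zero ∨ anyF (f ∘ Fin.suc)
  where import Data.Fin as Fin

module _ {n : ℕ} (P : FinBoundedPoset n) where
  open FinBoundedPoset P

  _<_ : Rel (Fin n) 0ℓ
  p < q = p ≤ q × p ≢ q

  private
    leb : Fin n → Fin n → Bool
    leb p q = isYes (p ≤? q)
    ltb : Fin n → Fin n → Bool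
    ltb p q = leb p q ∧ not (isYes (p ≟ q))
    mem : Fin n → Subset n → Bool
    mem p A = lookup A p

  IsAntichain : Subset n → Set
  IsAntichain A = ∀ a b → a ∈ A → b ∈ A → a ≤ b → a ≡ b

  𝔍 : Subset n → Subset n
  𝔍 A = tabulate λ p → anyF λ a → mem a A ∧ leb p a

  𝔉 : Subset n → Subset n
  𝔉 A = tabulate λ p → anyF λ a → mem a A ∧ leb a p

  maxS : Subset n → Subset n
  maxS Q = tabulate λ q → mem q Q ∧ not (anyF λ p → mem p Q ∧ ltb q p)

  _∧△_ : Subset n → Subset n → Subset n
  A ∧△ B = maxS (𝔍 A ∩ 𝔍 B)

  _≤△_ : Subset n → Subset n → Set
  A ≤△ B = Data.Fin.Subset._⊆_ (𝔍 A) (𝔍 B)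
    where import Data.Fin.Subset

  -- admissible maps 𝔄_△(P) → {-1} ∪ ℕ  (values in ℤ, range constrained)
  record Admissible (ω : Subset n → ℤ) : Set where
    field
      range : ∀ A → IsAntichain A → -1ℤ ℤ.≤ ω A
      empty : ω ⊥ ≡ -1ℤ
      zerô  : ω ⁅ bot ⁆ ≡ 0ℤ
      mono  : ∀ A B → IsAntichain A → IsAntichain B →
              ⁅ bot ⁆ ≤△ A → A ≢ ⁅ bot ⁆ → A ≤△ B →
              (0ℤ ℤ.< ω A) × (ω A ℤ.≤ ω B)

  NontrivialAntichain : Subset n → Set
  NontrivialAntichain A = IsAntichain A × A ≢ ⊥ × A ≢ ⁅ bot ⁆

  minP : Pred (Fin n) 0ℓ → Pred (Fin n) 0ℓ
  minP Q x = Q x × (∀ y → Q y → ¬ (y < x))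

  𝔉P : Pred (Fin n) 0ℓ → Pred (Fin n) 0ℓ
  𝔉P S x = ∃ λ s → S s × s ≤ x

  _∧▽_ : Pred (Fin n) 0ℓ → Pred (Fin n) 0ℓ → Pred (Fin n) 0ℓ
  X ∧▽ Y = minP (λ x → 𝔉P X x × 𝔉P Y x)

  module _ (ω : Subset n → ℤ) where

    -- absolute j-blocker  b_j(A) = min{ b : ω({b} ∧_△ {a}) > j  ∀ a ∈ A }
    -- (for j = ω(P) this is automatically ∅, matching the convention)
    blocker : ℤ → Subset n → Pred (Fin n) 0ℓ
    blocker j A = minP λ b → ∀ a → a ∈ A → j ℤ.< ω (⁅ b ⁆ ∧△ ⁅ a ⁆)

    blocker1 : ℤ → Pred (Fin n) 0ℓ
    blocker1 j = blocker j ⁅ top ⁆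

-- quotient p / q of integers as a rational (only used with q > 0;
-- conventionally 0 otherwise)
frac : ℤ → ℤ → ℚ
frac p (+ suc k) = p ℚ./ suc k
frac p _         = ℚ.0ℚ

toℚ : ℕ → ℚ
toℚ k = + k ℚ./ 1

-- ν(x) = ⌈x⌉ if x ∉ ℕ, and x + 1 if x ∈ ℕ  (used for x = r k ≥ 0,
-- where x ∈ ℕ iff its reduced denominator is 1)
ν : ℚ → ℤ
ν x with ℚ.denominatorℕ x ℕ.≟ 1
... | yes _ = ℚ.numerator x ℤ.+ 1ℤ
... | no  _ = ℚ.⌈ x ⌉

module _ {n : ℕ} (P : FinBoundedPoset n) where
  open FinBoundedPoset P

  𝐈 : ℚ → Subset n → (Subset n → ℤ) → Pred (Fin n) 0ℓ
  𝐈 r A ω b = b ≢ bot × (∀ a → a ∈ A → r ℚ.< frac (ω (_∧△_ P ⁅ b ⁆ ⁅ a ⁆)) (ω ⁅ b ⁆))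

  _⋖_ : Rel (Fin n) 0ℓ
  p ⋖ q = _<_ P p q × (∀ z → ¬ (_<_ P p z × _<_ P z q))

  IsRankFunction : (Fin n → ℕ) → Set
  IsRankFunction ρ = ρ bot ≡ 0 × (∀ p q → p ⋖ q → ρ q ≡ suc (ρ p))

rankMap : ∀ {n} → (Fin n → ℕ) → Subset n → ℤ
rankMap ρ []            = -1ℤ
rankMap ρ (true  ∷ A)   = (+ ρ Fin.zero) ℤ.⊔ rankMap (ρ ∘ Fin.suc) A
  where import Data.Fin as Fin
rankMap ρ (false ∷ A)   = rankMap (ρ ∘ Fin.suc) A
  where import Data.Fin as Fin

-- For x ≠ 0̂ with ω(x) = k > 0, the condition ω({x} ∧ {a}) / k > r is equivalent to
-- ω({x} ∧ {a}) ≥ ν(rk), because ν(rk) is the least integer strictly above rk.  For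
-- j ≥ 0 the set of x with ω({x} ∧ {a}) > j for all a ∈ A is an up-set, since
-- x ↦ ω({x} ∧ {a}) is monotone wherever it is positive; in a finite poset it is
-- therefore the filter generated by its minimal elements, the blocker b_j(A).  With
-- A = {1̂} this reads 𝔉(b_j(1̂)) = {x : ω(x) > j}, so 𝔉(b_{k-1}(1̂)) − 𝔉(b_k(1̂)) is the
-- level ω = k, and (i) is the union of these descriptions over k; its ∧▽ form follows from
-- 𝔉(X ∧▽ Y) = 𝔉 X ∩ 𝔉 Y.  Part (ii) is (i) for the admissible map of a rank function,
-- where ω({x} ∧ {a}) ≤ ρ(a) accounts for the side condition ν(rk) ≤ ρ(a).

module Submission where

open import Level using (0ℓ)
open import Data.Bool using (Bool; true; false; T; not; _∧_)
open import Data.Bool.Properties using (T-≡; T-∨; T-∧)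
open import Data.Empty using (⊥-elim; ⊥-elim-irr)
open import Data.Fin as Fin using (Fin)
open import Data.Fin.Induction using (po-wellFounded; po-noetherian)
open import Data.Fin.Properties using (any?; all?)
open import Data.Fin.Subset using (Subset; _∈_; _∩_; ⁅_⁆; _⊆_; ⊥)
open import Data.Fin.Subset.Properties using (_∈?_; x∈p∩q⁺; x∈p∩q⁻; x∈⁅x⁆; x∈⁅y⁆⇒x≡y; ⊆-antisym)
open import Data.Integer as ℤ using (ℤ; +_; +[1+_]; 1ℤ; 0ℤ; -1ℤ; +≤+; +<+)
import Data.Integer.Properties as ℤ
open import Data.Integer.DivMod using (div-pos-is-/ℕ; [n/ℕd]*d≤n; n<s[n/ℕd]*d)
open import Data.Nat as ℕ using (ℕ; zero; suc; z≤n; s≤s)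
import Data.Nat.Properties as ℕ
open import Data.Nat.Divisibility using (divides; ∣-refl)
open import Data.Product using (Σ; _,_; _×_; ∃; proj₁; proj₂)
open import Data.Rational as ℚ using (ℚ; mkℚ; 0ℚ; 1ℚ; ↥_; ↧_)
import Data.Rational.Properties as ℚ
import Data.Rational.Unnormalised as ℚᵘ
import Data.Rational.Unnormalised.Properties as ℚᵘ
open import Data.Sum using (_⊎_; inj₁; inj₂)
open import Data.Unit using (tt)
open import Data.Vec using ([]; _∷_; here; there; lookup; tabulate)
open import Data.Vec.Properties using (lookup∘tabulate; []=⇒lookup; lookup⇒[]=)
open import Function using (_⇔_; mk⇔; Equivalence; _∘_; flip)
import Function.Properties.Equivalence as ⇔
open import Induction.WellFounded using (WellFounded; Acc; acc)
open import Relation.Binary using () renaming (Decidable to Decidable₂)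
import Relation.Binary.Construct.NonStrictToStrict as ToStrict
open import Relation.Binary.PropositionalEquality
  using (_≡_; _≢_; refl; sym; trans; cong; subst; subst₂)
open import Relation.Binary.Structures using (IsDecPartialOrder)
open import Relation.Nullary using (¬_; yes; no)
open import Relation.Nullary.Decidable using (map′; isYes; toWitness; fromWitness; _×-dec_; _→-dec_)
open import Relation.Unary using (Pred; Decidable; _≐_)
open import Relation.Unary.Properties using (≐-trans)

open import Defs hiding (_<_)

open Equivalence

≤/⇔*≤ : ∀ c i d → c ℤ.≤ i ℤ./ +[1+ d ] ⇔ c ℤ.* +[1+ d ] ℤ.≤ i
≤/⇔*≤ c i d = mk⇔ ≤/⇒*≤ *≤⇒≤/
  where
  D : ℤ
  D = +[1+ d ]
  i/D≡i/ℕD : i ℤ./ D ≡ i ℤ./ℕ suc d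
  i/D≡i/ℕD = div-pos-is-/ℕ i (suc d)
  ≤/⇒*≤ : c ℤ.≤ i ℤ./ D → c ℤ.* D ℤ.≤ i
  ≤/⇒*≤ c≤i/D = ℤ.≤-trans (ℤ.*-monoʳ-≤-nonNeg D (subst (c ℤ.≤_) i/D≡i/ℕD c≤i/D))
                           ([n/ℕd]*d≤n i (suc d))
  *≤⇒≤/ : c ℤ.* D ℤ.≤ i → c ℤ.≤ i ℤ./ D
  *≤⇒≤/ cD≤i = subst (c ℤ.≤_) (sym i/D≡i/ℕD) (ℤ.≮⇒≥ λ i/D<c →
    ℤ.<⇒≱ (n<s[n/ℕd]*d i (suc d))
          (ℤ.≤-trans (ℤ.*-monoʳ-≤-nonNeg D (ℤ.i<j⇒suc[i]≤j i/D<c)) cD≤i))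

neg≤⇔neg≤ : ∀ i j → ℤ.- i ℤ.≤ j ⇔ ℤ.- j ℤ.≤ i
neg≤⇔neg≤ i j = mk⇔ (flipNeg i j) (flipNeg j i)
  where
  flipNeg : ∀ i j → ℤ.- i ℤ.≤ j → ℤ.- j ℤ.≤ i
  flipNeg i j -i≤j = subst (ℤ.- j ℤ.≤_) (ℤ.neg-involutive i) (ℤ.neg-mono-≤ -i≤j)

ceiling≡-floor-neg : ∀ q → ℚ.⌈ q ⌉ ≡ ℤ.- ((ℤ.- ↥ q) ℤ./ ↧ q)
ceiling≡-floor-neg (mkℚ (+ 0) d c) = refl
ceiling≡-floor-neg (mkℚ +[1+ n ] d c) = refl
ceiling≡-floor-neg (mkℚ ℤ.-[1+ n ] d c) = refl

⌈⌉≤⇔ : ∀ q m → ℚ.⌈ q ⌉ ℤ.≤ m ⇔ ↥ q ℤ.≤ m ℤ.* ↧ q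
⌈⌉≤⇔ q@(mkℚ p d _) m rewrite ceiling≡-floor-neg q =
  ⇔.trans (neg≤⇔neg≤ _ m) (⇔.trans (≤/⇔*≤ (ℤ.- m) (ℤ.- p) d)
    (subst (λ x → x ℤ.≤ ℤ.- p ⇔ p ℤ.≤ m ℤ.* +[1+ d ]) (ℤ.neg-distribˡ-* m +[1+ d ])
      (mk⇔ ℤ.neg-cancel-≤ ℤ.neg-mono-≤)))

ν≤⇔ : ∀ q m → ν q ℤ.≤ m ⇔ ↥ q ℤ.< m ℤ.* ↧ q
ν≤⇔ q@(mkℚ p d coprime) m with suc d ℕ.≟ 1
... | yes refl = subst₂ (λ x y → x ℤ.≤ m ⇔ p ℤ.< y) (ℤ.+-comm 1ℤ p) (sym (ℤ.*-identityʳ m))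
                   (mk⇔ ℤ.suc[i]≤j⇒i<j ℤ.i<j⇒suc[i]≤j)
... | no ↧q≢1 = ⇔.trans (⌈⌉≤⇔ q m) (mk⇔ (λ p≤mD → ℤ.≤∧≢⇒< p≤mD p≢mD) ℤ.<⇒≤)
  where
  -- otherwise ↧ q ≠ 1 would divide the coprime numerator
  p≢mD : p ≢ m ℤ.* +[1+ d ]
  p≢mD p≡mD = ⊥-elim-irr (↧q≢1 (coprime (divides ℤ.∣ m ∣ ∣p∣≡∣m∣D , ∣-refl)))
    where
    ∣p∣≡∣m∣D : ℤ.∣ p ∣ ≡ ℤ.∣ m ∣ ℕ.* suc d
    ∣p∣≡∣m∣D = trans (cong ℤ.∣_∣ p≡mD) (ℤ.abs-* m +[1+ d ])

<-fromℚᵘ⇔ : ∀ p u → p ℚ.< ℚ.fromℚᵘ u ⇔ ℚ.toℚᵘ p ℚᵘ.< u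
<-fromℚᵘ⇔ p u = mk⇔
  (λ p<u → ℚᵘ.<-respʳ-≃ (ℚ.toℚᵘ-fromℚᵘ u) (ℚ.toℚᵘ-mono-< p<u))
  (λ p<u → ℚ.toℚᵘ-cancel-< (ℚᵘ.<-respʳ-≃ (ℚᵘ.≃-sym (ℚ.toℚᵘ-fromℚᵘ u)) p<u))

<ᵘ⇔ : ∀ p q → p ℚᵘ.< q ⇔ ℚᵘ.↥ p ℤ.* ℚᵘ.↧ q ℤ.< ℚᵘ.↥ q ℤ.* ℚᵘ.↧ p
<ᵘ⇔ p q = mk⇔ ℚᵘ.drop-*<* ℚᵘ.*<*

<-/1⇔ : ∀ q m → q ℚ.< m ℚ./ 1 ⇔ ↥ q ℤ.< m ℤ.* ↧ q
<-/1⇔ q@(mkℚ a b _) m = subst (λ x → q ℚ.< m ℚ./ 1 ⇔ x ℤ.< m ℤ.* +[1+ b ]) (ℤ.*-identityʳ a)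
  (⇔.trans (<-fromℚᵘ⇔ q (ℚᵘ.mkℚᵘ m 0)) (<ᵘ⇔ _ _))

<-frac⇔ : ∀ r m K → r ℚ.< frac m (+ suc K) ⇔ ↥ r ℤ.* + suc K ℤ.< m ℤ.* ↧ r
<-frac⇔ r@(mkℚ _ _ _) m K = ⇔.trans (<-fromℚᵘ⇔ r (ℚᵘ.mkℚᵘ m K)) (<ᵘ⇔ _ _)

*<-/1⇔ : ∀ r m K → r ℚ.* toℚ (suc K) ℚ.< m ℚ./ 1 ⇔ ↥ r ℤ.* + suc K ℤ.< m ℤ.* ↧ r
*<-/1⇔ r@(mkℚ a b _) m K =
  ⇔.trans (<-fromℚᵘ⇔ (r ℚ.* toℚ (suc K)) (ℚᵘ.mkℚᵘ m 0))
  (⇔.trans (mk⇔ (ℚᵘ.<-respˡ-≃ toℚᵘ-r*k) (ℚᵘ.<-respˡ-≃ (ℚᵘ.≃-sym toℚᵘ-r*k)))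
  (⇔.trans (<ᵘ⇔ _ _)
    (subst₂ (λ x y → x ℤ.< m ℤ.* + suc y ⇔ a ℤ.* + suc K ℤ.< m ℤ.* +[1+ b ])
      (sym (ℤ.*-identityʳ (a ℤ.* + suc K))) (sym (ℕ.*-identityʳ b)) ⇔.refl)))
  where
  toℚᵘ-r*k : ℚ.toℚᵘ (r ℚ.* toℚ (suc K)) ℚᵘ.≃ ℚᵘ.mkℚᵘ a b ℚᵘ.* ℚᵘ.mkℚᵘ (+ suc K) 0
  toℚᵘ-r*k = ℚᵘ.≃-trans (ℚ.toℚᵘ-homo-* r (toℚ (suc K)))
                         (ℚᵘ.*-congˡ {ℚᵘ.mkℚᵘ a b} (ℚ.toℚᵘ-fromℚᵘ (ℚᵘ.mkℚᵘ (+ suc K) 0)))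

ν≤⇔</1 : ∀ q m → ν q ℤ.≤ m ⇔ q ℚ.< m ℚ./ 1
ν≤⇔</1 q m = ⇔.trans (ν≤⇔ q m) (⇔.sym (<-/1⇔ q m))

<-frac⇔ν≤ : ∀ r m K → r ℚ.< frac m (+ suc K) ⇔ ν (r ℚ.* toℚ (suc K)) ℤ.≤ m
<-frac⇔ν≤ r m K = ⇔.trans (<-frac⇔ r m K)
  (⇔.trans (⇔.sym (*<-/1⇔ r m K)) (⇔.sym (ν≤⇔</1 (r ℚ.* toℚ (suc K)) m)))

ν-positive : ∀ r K → 0ℚ ℚ.≤ r → 1ℤ ℤ.≤ ν (r ℚ.* toℚ (suc K))
ν-positive r K 0≤r = ℤ.≮⇒≥ λ ν<1 →
  ℚ.<-irrefl refl (ℚ.≤-<-trans 0≤rk (to (ν≤⇔</1 (r ℚ.* toℚ (suc K)) 0ℤ) (ℤ.i<j⇒i≤pred[j] ν<1)))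
  where
  0≤rk : 0ℚ ℚ.≤ r ℚ.* toℚ (suc K)
  0≤rk = ℚ.nonNegative⁻¹ _ {{ℚ.nonNeg*nonNeg⇒nonNeg r {{ℚ.nonNegative 0≤r}} (toℚ (suc K))
                                {{ℚ.normalize-nonNeg (suc K) 1}}}}

-1<⇔≤ : ∀ i j → i ℤ.- 1ℤ ℤ.< j ⇔ i ℤ.≤ j
-1<⇔≤ i j = subst (λ x → x ℤ.< j ⇔ i ℤ.≤ j) (sym i-1≡pred[i])
  (mk⇔ (λ pred[i]<j → subst (ℤ._≤ j) (ℤ.suc-pred i) (ℤ.i<j⇒suc[i]≤j pred[i]<j))
       (λ i≤j → ℤ.suc[i]≤j⇒i<j (subst (ℤ._≤ j) (sym (ℤ.suc-pred i)) i≤j)))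
  where
  i-1≡pred[i] : i ℤ.- 1ℤ ≡ ℤ.pred i
  i-1≡pred[i] = ℤ.+-comm i ℤ.-1ℤ

0<⇒≡+suc : ∀ {i} → 0ℤ ℤ.< i → ∃ λ K → i ≡ + suc K
0<⇒≡+suc {+ suc K} _ = K , refl
0<⇒≡+suc {+ zero} (+<+ ())

T-anyF : ∀ {n} (f : Fin n → Bool) → T (anyF f) ⇔ ∃ (T ∘ f)
T-anyF {zero}  f = mk⇔ (λ ()) λ ()
T-anyF {suc n} f = ⇔.trans T-∨ (mk⇔ to′ from′)
  where
  to′ : T (f Fin.zero) ⊎ T (anyF (f ∘ Fin.suc)) → ∃ (T ∘ f)
  to′ (inj₁ t) = Fin.zero , t
  to′ (inj₂ t) = let i , fi = to (T-anyF (f ∘ Fin.suc)) t in Fin.suc i , fi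
  from′ : ∃ (T ∘ f) → T (f Fin.zero) ⊎ T (anyF (f ∘ Fin.suc))
  from′ (Fin.zero  , t) = inj₁ t
  from′ (Fin.suc i , t) = inj₂ (from (T-anyF (f ∘ Fin.suc)) (i , t))

T-not⇔¬T : ∀ {b} → T (not b) ⇔ (¬ T b)
T-not⇔¬T {false} = mk⇔ (λ _ ()) (λ _ → tt)
T-not⇔¬T {true}  = mk⇔ (λ ()) (λ ¬t → ¬t tt)

∈tabulate⇔ : ∀ {n} {f : Fin n → Bool} {x} → x ∈ tabulate f ⇔ T (f x)
∈tabulate⇔ {f = f} {x} = mk⇔
  (λ x∈ → from T-≡ (trans (sym (lookup∘tabulate f x)) ([]=⇒lookup x∈)))
  (λ t → lookup⇒[]= x (tabulate f) (trans (lookup∘tabulate f x) (to T-≡ t)))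

∈⇔T-lookup : ∀ {n} {x : Fin n} {A} → x ∈ A ⇔ T (lookup A x)
∈⇔T-lookup {x = x} {A} = mk⇔ (from T-≡ ∘ []=⇒lookup) (lookup⇒[]= x A ∘ to T-≡)

⁅⁆-injective : ∀ {n} {x y : Fin n} → ⁅ x ⁆ ≡ ⁅ y ⁆ → x ≡ y
⁅⁆-injective {x = x} {y} ⁅x⁆≡⁅y⁆ = x∈⁅y⁆⇒x≡y y (subst (x ∈_) ⁅x⁆≡⁅y⁆ (x∈⁅x⁆ x))

module PosetProperties {n : ℕ} (P : FinBoundedPoset n) where
  open FinBoundedPoset P
  open IsDecPartialOrder isDecPO using (isPartialOrder; antisym)
  open IsDecPartialOrder isDecPO public using () renaming (refl to ≤-refl; trans to ≤-trans)
  open ToStrict _≡_ _≤_ public using (_<_; <⇒≤)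

  _<?_ : Decidable₂ _<_
  _<?_ = ToStrict.<-decidable _≡_ _≤_ _≟_ _≤?_

  <-wellFounded : WellFounded _<_
  <-wellFounded = po-wellFounded isPartialOrder

  maxP : Pred (Fin n) 0ℓ → Pred (Fin n) 0ℓ
  maxP Q x = Q x × (∀ y → Q y → ¬ x < y)

  minimal-below : ∀ {Q} → Decidable Q → ∀ {x} → Q x → ∃ λ s → minP P Q s × s ≤ x
  minimal-below {Q} Q? {x} = go x (<-wellFounded x)
    where
    go : ∀ x → Acc _<_ x → Q x → ∃ λ s → minP P Q s × s ≤ x
    go x (acc rec) Qx with any? (λ y → Q? y ×-dec y <? x)
    ... | yes (y , Qy , y<x) = let s , s-min , s≤y = go y (rec y<x) Qy in
                               s , s-min , ≤-trans s≤y (<⇒≤ y<x)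
    ... | no ∄y = x , (Qx , λ y Qy y<x → ∄y (y , Qy , y<x)) , ≤-refl

  maximal-above : ∀ {Q} → Decidable Q → ∀ {x} → Q x → ∃ λ m → maxP Q m × x ≤ m
  maximal-above {Q} Q? {x} = go x (po-noetherian isPartialOrder x)
    where
    go : ∀ x → Acc (flip _<_) x → Q x → ∃ λ m → maxP Q m × x ≤ m
    go x (acc rec) Qx with any? (λ y → Q? y ×-dec x <? y)
    ... | yes (y , Qy , x<y) = let m , m-max , y≤m = go y (rec x<y) Qy in
                               m , m-max , ≤-trans (<⇒≤ x<y) y≤m
    ... | no ∄y = x , (Qx , λ y Qy x<y → ∄y (y , Qy , x<y)) , ≤-refl

  ∈𝔍⇔ : ∀ A {p} → p ∈ 𝔍 P A ⇔ ∃ λ a → a ∈ A × p ≤ a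
  ∈𝔍⇔ A = mk⇔
    (λ p∈ → let a , t = to (T-anyF _) (to ∈tabulate⇔ p∈) ; a∈ , p≤a = to T-∧ t in
            a , from ∈⇔T-lookup a∈ , toWitness p≤a)
    (λ (a , a∈ , p≤a) →
       from ∈tabulate⇔ (from (T-anyF _) (a , from T-∧ (to ∈⇔T-lookup a∈ , fromWitness p≤a))))

  ∈maxS⇔ : ∀ Q {p} → p ∈ maxS P Q ⇔ maxP (_∈ Q) p
  ∈maxS⇔ Q {p} = mk⇔
    (λ p∈ → let p∈Q , ∄q = to T-∧ (to ∈tabulate⇔ p∈) in
            from ∈⇔T-lookup p∈Q , λ q q∈Q p<q →
              to T-not⇔¬T ∄q (from (T-anyF _) (q , from T-∧ (to ∈⇔T-lookup q∈Q , <⇒T p<q))))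
    (λ (p∈Q , p-max) → from ∈tabulate⇔ (from T-∧ (to ∈⇔T-lookup p∈Q , from T-not⇔¬T λ t →
       let q , tq = to (T-anyF _) t ; q∈Q , p<q = to T-∧ tq in
       p-max q (from ∈⇔T-lookup q∈Q) (T⇒< p<q))))
    where
    <⇒T : ∀ {q} → p < q → T (isYes (p ≤? q) ∧ not (isYes (p ≟ q)))
    <⇒T {q} (p≤q , p≢q) = from (T-∧ {isYes (p ≤? q)})
      (fromWitness p≤q , from T-not⇔¬T (p≢q ∘ toWitness {a? = p ≟ q}))
    T⇒< : ∀ {q} → T (isYes (p ≤? q) ∧ not (isYes (p ≟ q))) → p < q
    T⇒< {q} t = let p≤q , p≢q = to (T-∧ {isYes (p ≤? q)}) t in
      toWitness p≤q , to T-not⇔¬T p≢q ∘ fromWitness {a? = p ≟ q}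

  𝔍-downward : ∀ A {p q} → p ≤ q → q ∈ 𝔍 P A → p ∈ 𝔍 P A
  𝔍-downward A p≤q q∈ = let a , a∈ , q≤a = to (∈𝔍⇔ A) q∈ in from (∈𝔍⇔ A) (a , a∈ , ≤-trans p≤q q≤a)

  ∈𝔍⁅⁆⇔ : ∀ x {p} → p ∈ 𝔍 P ⁅ x ⁆ ⇔ p ≤ x
  ∈𝔍⁅⁆⇔ x {p} = mk⇔
    (λ p∈ → let a , a∈ , p≤a = to (∈𝔍⇔ ⁅ x ⁆) p∈ in subst (p ≤_) (x∈⁅y⁆⇒x≡y _ a∈) p≤a)
    (λ p≤x → from (∈𝔍⇔ ⁅ x ⁆) (x , x∈⁅x⁆ x , p≤x))

  ∈𝔍∧△⇔ : ∀ A B {p} → p ∈ 𝔍 P (_∧△_ P A B) ⇔ (p ∈ 𝔍 P A × p ∈ 𝔍 P B)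
  ∈𝔍∧△⇔ A B = mk⇔
    (λ p∈ → let m , m∈ , p≤m = to (∈𝔍⇔ (_∧△_ P A B)) p∈
                m∈A , m∈B = x∈p∩q⁻ (𝔍 P A) _ (proj₁ (to (∈maxS⇔ S) m∈)) in
            𝔍-downward A p≤m m∈A , 𝔍-downward B p≤m m∈B)
    (λ p∈A∩B → let m , m-max , p≤m = maximal-above (_∈? S) (x∈p∩q⁺ p∈A∩B) in
               from (∈𝔍⇔ (_∧△_ P A B)) (m , from (∈maxS⇔ S) m-max , p≤m))
    where
    S : Subset n
    S = 𝔍 P A ∩ 𝔍 P B

  ⁅⁆-mono-≤△ : ∀ {x y} → x ≤ y → _≤△_ P ⁅ x ⁆ ⁅ y ⁆
  ⁅⁆-mono-≤△ {x} {y} x≤y p∈ = from (∈𝔍⁅⁆⇔ y) (≤-trans (to (∈𝔍⁅⁆⇔ x) p∈) x≤y)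

  ∧△-monoˡ-≤△ : ∀ A A′ B → _≤△_ P A A′ → _≤△_ P (_∧△_ P A B) (_∧△_ P A′ B)
  ∧△-monoˡ-≤△ A A′ B A≤A′ p∈ =
    let p∈A , p∈B = to (∈𝔍∧△⇔ A B) p∈ in from (∈𝔍∧△⇔ A′ B) (A≤A′ p∈A , p∈B)

  ∧△-≤△ʳ : ∀ A B → _≤△_ P (_∧△_ P A B) B
  ∧△-≤△ʳ A B = proj₂ ∘ to (∈𝔍∧△⇔ A B)

  ⁅bot⁆-≤△ : ∀ A → bot ∈ 𝔍 P A → _≤△_ P ⁅ bot ⁆ A
  ⁅bot⁆-≤△ A bot∈ p∈ = 𝔍-downward A (to (∈𝔍⁅⁆⇔ bot) p∈) bot∈

  ⁅⁆-antichain : ∀ x → IsAntichain P ⁅ x ⁆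
  ⁅⁆-antichain x a b a∈ b∈ _ = trans (x∈⁅y⁆⇒x≡y x a∈) (sym (x∈⁅y⁆⇒x≡y x b∈))

  antichain∋bot⇒≡⁅bot⁆ : ∀ {A} → IsAntichain P A → bot ∈ A → A ≡ ⁅ bot ⁆
  antichain∋bot⇒≡⁅bot⁆ {A} A-antichain bot∈A = ⊆-antisym
    (λ {x} x∈A → subst (_∈ ⁅ bot ⁆) (A-antichain bot x bot∈A x∈A (bot-least x)) (x∈⁅x⁆ bot))
    (λ {x} x∈⁅bot⁆ → subst (_∈ A) (sym (x∈⁅y⁆⇒x≡y bot x∈⁅bot⁆)) bot∈A)

  maxS-antichain : ∀ Q → IsAntichain P (maxS P Q)
  maxS-antichain Q a b a∈ b∈ a≤b with a ≟ b
  ... | yes a≡b = a≡b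
  ... | no a≢b = ⊥-elim (proj₂ (to (∈maxS⇔ Q) a∈) b (proj₁ (to (∈maxS⇔ Q) b∈)) (a≤b , a≢b))

  ⁅⁆∧△⁅top⁆ : ∀ x → _∧△_ P ⁅ x ⁆ ⁅ top ⁆ ≡ ⁅ x ⁆
  ⁅⁆∧△⁅top⁆ x = ⊆-antisym ⊆⁅x⁆ ⁅x⁆⊆
    where
    S : Subset n
    S = 𝔍 P ⁅ x ⁆ ∩ 𝔍 P ⁅ top ⁆
    x∈S : x ∈ S
    x∈S = x∈p∩q⁺ (from (∈𝔍⁅⁆⇔ x) ≤-refl , from (∈𝔍⁅⁆⇔ top) (top-greatest x))
    ⊆⁅x⁆ : _∧△_ P ⁅ x ⁆ ⁅ top ⁆ ⊆ ⁅ x ⁆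
    ⊆⁅x⁆ {p} p∈ with p ≟ x | to (∈maxS⇔ S) p∈
    ... | yes refl | _ = x∈⁅x⁆ x
    ... | no p≢x | p∈S , p-max =
      ⊥-elim (p-max x x∈S (to (∈𝔍⁅⁆⇔ x) (proj₁ (x∈p∩q⁻ (𝔍 P ⁅ x ⁆) _ p∈S)) , p≢x))
    ⁅x⁆⊆ : ⁅ x ⁆ ⊆ _∧△_ P ⁅ x ⁆ ⁅ top ⁆
    ⁅x⁆⊆ p∈ rewrite x∈⁅y⁆⇒x≡y x p∈ = from (∈maxS⇔ S) (x∈S , λ q q∈S (x≤q , x≢q) →
      x≢q (antisym x≤q (to (∈𝔍⁅⁆⇔ x) (proj₁ (x∈p∩q⁻ (𝔍 P ⁅ x ⁆) _ q∈S)))))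

  𝔉P-upward : ∀ {X p q} → p ≤ q → 𝔉P P X p → 𝔉P P X q
  𝔉P-upward p≤q (s , Xs , s≤p) = s , Xs , ≤-trans s≤p p≤q

  𝔉P-∧▽⇔ : ∀ {X Y} → Decidable (λ z → 𝔉P P X z × 𝔉P P Y z) →
            ∀ {x} → 𝔉P P (_∧▽_ P X Y) x ⇔ (𝔉P P X x × 𝔉P P Y x)
  𝔉P-∧▽⇔ XY? = mk⇔
    (λ (s , ((s∈𝔉X , s∈𝔉Y) , _) , s≤x) → 𝔉P-upward s≤x s∈𝔉X , 𝔉P-upward s≤x s∈𝔉Y)
    (minimal-below XY?)

Blocking : ∀ {n} → FinBoundedPoset n → (Subset n → ℤ) → ℤ → Subset n → Pred (Fin n) 0ℓ
Blocking P ω j B b = ∀ a → a ∈ B → j ℤ.< ω (_∧△_ P ⁅ b ⁆ ⁅ a ⁆)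

module AdmissibleProperties {n : ℕ} {P : FinBoundedPoset n} {ω : Subset n → ℤ}
                            (adm : Admissible P ω) where
  open FinBoundedPoset P
  open Admissible adm
  open PosetProperties P

  ω-⁅⁆-mono : ∀ {x y} → x ≢ bot → x ≤ y → 0ℤ ℤ.< ω ⁅ x ⁆ × ω ⁅ x ⁆ ℤ.≤ ω ⁅ y ⁆
  ω-⁅⁆-mono {x} {y} x≢bot x≤y = mono ⁅ x ⁆ ⁅ y ⁆ (⁅⁆-antichain x) (⁅⁆-antichain y)
    (⁅⁆-mono-≤△ (bot-least x)) (x≢bot ∘ ⁅⁆-injective) (⁅⁆-mono-≤△ x≤y)

  ω-pos : ∀ {x} → x ≢ bot → 0ℤ ℤ.< ω ⁅ x ⁆
  ω-pos x≢bot = proj₁ (ω-⁅⁆-mono x≢bot ≤-refl)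

  ω-≤-top : ∀ x → ω ⁅ x ⁆ ℤ.≤ ω ⁅ top ⁆
  ω-≤-top x with x ≟ bot | top ≟ bot
  ... | no x≢bot | _ = proj₂ (ω-⁅⁆-mono x≢bot (top-greatest x))
  ... | yes refl | yes top≡bot = ℤ.≤-reflexive (cong (ω ∘ ⁅_⁆) (sym top≡bot))
  ... | yes refl | no top≢bot = ℤ.≤-trans (ℤ.≤-reflexive zerô) (ℤ.<⇒≤ (ω-pos top≢bot))

  ω-∧△-mono : ∀ {x y} a → x ≤ y → 0ℤ ℤ.< ω (_∧△_ P ⁅ x ⁆ ⁅ a ⁆) →
              ω (_∧△_ P ⁅ x ⁆ ⁅ a ⁆) ℤ.≤ ω (_∧△_ P ⁅ y ⁆ ⁅ a ⁆)
  ω-∧△-mono {x} {y} a x≤y 0<ω =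
    proj₂ (mono ⁅x⁆∧△⁅a⁆ (_∧△_ P ⁅ y ⁆ ⁅ a ⁆) (maxS-antichain Sx) (maxS-antichain Sy)
                (⁅bot⁆-≤△ ⁅x⁆∧△⁅a⁆ (from (∈𝔍∧△⇔ ⁅ x ⁆ ⁅ a ⁆)
                   (from (∈𝔍⁅⁆⇔ x) (bot-least x) , from (∈𝔍⁅⁆⇔ a) (bot-least a))))
                (λ meet≡⁅bot⁆ → ℤ.<-irrefl (sym (trans (cong ω meet≡⁅bot⁆) zerô)) 0<ω)
                (∧△-monoˡ-≤△ ⁅ x ⁆ ⁅ y ⁆ ⁅ a ⁆ (⁅⁆-mono-≤△ x≤y)))
    where
    Sx Sy ⁅x⁆∧△⁅a⁆ : Subset n
    Sx = 𝔍 P ⁅ x ⁆ ∩ 𝔍 P ⁅ a ⁆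
    Sy = 𝔍 P ⁅ y ⁆ ∩ 𝔍 P ⁅ a ⁆
    ⁅x⁆∧△⁅a⁆ = _∧△_ P ⁅ x ⁆ ⁅ a ⁆

  ω≡+suc⇒≢bot : ∀ {x K} → ω ⁅ x ⁆ ≡ + suc K → x ≢ bot
  ω≡+suc⇒≢bot ωx≡ refl with () ← trans (sym zerô) ωx≡

  blocking? : ∀ j B → Decidable (Blocking P ω j B)
  blocking? j B b = all? λ a → (a ∈? B) →-dec (j ℤ.<? ω (_∧△_ P ⁅ b ⁆ ⁅ a ⁆))

  blocking-upward : ∀ {j B s x} → 0ℤ ℤ.≤ j → s ≤ x → Blocking P ω j B s → Blocking P ω j B x
  blocking-upward 0≤j s≤x s-blocks a a∈B =
    ℤ.<-≤-trans (s-blocks a a∈B) (ω-∧△-mono a s≤x (ℤ.≤-<-trans 0≤j (s-blocks a a∈B)))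

  ∈𝔉blocker⇔ : ∀ {j B x} → 0ℤ ℤ.≤ j → 𝔉P P (blocker P ω j B) x ⇔ Blocking P ω j B x
  ∈𝔉blocker⇔ {j} {B} 0≤j = mk⇔
    (λ (s , (s-blocks , _) , s≤x) → blocking-upward 0≤j s≤x s-blocks)
    (minimal-below (blocking? j B))

  𝔉blocker? : ∀ {j} B → 0ℤ ℤ.≤ j → Decidable (𝔉P P (blocker P ω j B))
  𝔉blocker? B 0≤j x = map′ (from (∈𝔉blocker⇔ 0≤j)) (to (∈𝔉blocker⇔ 0≤j)) (blocking? _ B x)

  ∈𝔉blocker1⇔ : ∀ {j x} → 0ℤ ℤ.≤ j → 𝔉P P (blocker1 P ω j) x ⇔ j ℤ.< ω ⁅ x ⁆
  ∈𝔉blocker1⇔ {j} {x} 0≤j = ⇔.trans (∈𝔉blocker⇔ 0≤j) (mk⇔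
    (λ x-blocks → subst (λ X → j ℤ.< ω X) (⁅⁆∧△⁅top⁆ x) (x-blocks top (x∈⁅x⁆ top)))
    (λ j<ωx a a∈ → subst (λ a → j ℤ.< ω (_∧△_ P ⁅ x ⁆ ⁅ a ⁆)) (sym (x∈⁅y⁆⇒x≡y top a∈))
                     (subst (λ X → j ℤ.< ω X) (sym (⁅⁆∧△⁅top⁆ x)) j<ωx)))

  ∈𝔉blocker1-level⇔ : ∀ K {x} →
    (𝔉P P (blocker1 P ω (+ suc K ℤ.- 1ℤ)) x × ¬ 𝔉P P (blocker1 P ω (+ suc K)) x) ⇔ ω ⁅ x ⁆ ≡ + suc K
  ∈𝔉blocker1-level⇔ K {x} = mk⇔
    (λ (above , ¬above) → ℤ.≤-antisym (ℤ.≮⇒≥ (¬above ∘ from (∈𝔉blocker1⇔ 0≤k)))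
                                       (to (-1<⇔≤ _ _) (to (∈𝔉blocker1⇔ 0≤k-1) above)))
    (λ ωx≡k → from (∈𝔉blocker1⇔ 0≤k-1) (from (-1<⇔≤ _ _) (ℤ.≤-reflexive (sym ωx≡k))) ,
              λ above → ℤ.<-irrefl (sym ωx≡k) (to (∈𝔉blocker1⇔ 0≤k) above))
    where
    0≤k : 0ℤ ℤ.≤ + suc K
    0≤k = +≤+ z≤n
    0≤k-1 : 0ℤ ℤ.≤ + suc K ℤ.- 1ℤ
    0≤k-1 = ℤ.i≤j⇒0≤j-i (+≤+ (s≤s z≤n))

  module _ {r : ℚ} (0≤r : 0ℚ ℚ.≤ r) (A : Subset n) where

    ∈𝔉blocker-ν⇔ : ∀ K {x} →
      𝔉P P (blocker P ω (ν (r ℚ.* toℚ (suc K)) ℤ.- 1ℤ) A) x ⇔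
      (∀ a → a ∈ A → ν (r ℚ.* toℚ (suc K)) ℤ.≤ ω (_∧△_ P ⁅ x ⁆ ⁅ a ⁆))
    ∈𝔉blocker-ν⇔ K = ⇔.trans (∈𝔉blocker⇔ (ℤ.i≤j⇒0≤j-i (ν-positive r K 0≤r)))
      (mk⇔ (λ x-blocks a a∈ → to (-1<⇔≤ _ _) (x-blocks a a∈))
           (λ ν≤ a a∈ → from (-1<⇔≤ _ _) (ν≤ a a∈)))

    ∈𝐈⇔ : ∀ {x} → 𝐈 P r A ω x ⇔
      ∃ λ K → ω ⁅ x ⁆ ≡ + suc K × (∀ a → a ∈ A → ν (r ℚ.* toℚ (suc K)) ℤ.≤ ω (_∧△_ P ⁅ x ⁆ ⁅ a ⁆))
    ∈𝐈⇔ {x} = mk⇔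
      (λ (x≢bot , r<) → let K , ωx≡ = 0<⇒≡+suc (ω-pos x≢bot) in
        K , ωx≡ , λ a a∈ → to (<-frac⇔ν≤ r _ K) (subst (r<frac a) ωx≡ (r< a a∈)))
      (λ (K , ωx≡ , ν≤) → ω≡+suc⇒≢bot ωx≡ ,
        λ a a∈ → subst (r<frac a) (sym ωx≡) (from (<-frac⇔ν≤ r _ K) (ν≤ a a∈)))
      where
      r<frac : Fin n → ℤ → Set
      r<frac a w = r ℚ.< frac (ω (_∧△_ P ⁅ x ⁆ ⁅ a ⁆)) w

    ⋃level∩𝔉blocker : Pred (Fin n) 0ℓ
    ⋃level∩𝔉blocker x = Σ ℕ λ k → (1 ℕ.≤ k × + k ℤ.≤ ω ⁅ top ⁆) ×
      ((𝔉P P (blocker1 P ω (+ k ℤ.- 1ℤ)) x × ¬ 𝔉P P (blocker1 P ω (+ k)) x) ×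
       𝔉P P (blocker P ω (ν (r ℚ.* toℚ k) ℤ.- 1ℤ) A) x)

    ⋃𝔉meet∖𝔉blocker1 : Pred (Fin n) 0ℓ
    ⋃𝔉meet∖𝔉blocker1 x = Σ ℕ λ k → (1 ℕ.≤ k × + k ℤ.≤ ω ⁅ top ⁆) ×
      (𝔉P P (_∧▽_ P (blocker1 P ω (+ k ℤ.- 1ℤ)) (blocker P ω (ν (r ℚ.* toℚ k) ℤ.- 1ℤ) A)) x ×
       ¬ 𝔉P P (blocker1 P ω (+ k)) x)

    𝐈≐⋃level∩𝔉blocker : 𝐈 P r A ω ≐ ⋃level∩𝔉blocker
    𝐈≐⋃level∩𝔉blocker = ⊆ , ⊇
      where
      ⊆ : ∀ {x} → 𝐈 P r A ω x → ⋃level∩𝔉blocker x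
      ⊆ {x} x∈𝐈 = let K , ωx≡ , ν≤ = to ∈𝐈⇔ x∈𝐈 in
        suc K , (s≤s z≤n , subst (ℤ._≤ ω ⁅ top ⁆) ωx≡ (ω-≤-top x)) ,
        from (∈𝔉blocker1-level⇔ K) ωx≡ , from (∈𝔉blocker-ν⇔ K) ν≤
      ⊇ : ∀ {x} → ⋃level∩𝔉blocker x → 𝐈 P r A ω x
      ⊇ (suc K , _ , level , x∈𝔉) =
        from ∈𝐈⇔ (K , to (∈𝔉blocker1-level⇔ K) level , to (∈𝔉blocker-ν⇔ K) x∈𝔉)

    ⋃level∩𝔉blocker≐⋃𝔉meet∖𝔉blocker1 : ⋃level∩𝔉blocker ≐ ⋃𝔉meet∖𝔉blocker1
    ⋃level∩𝔉blocker≐⋃𝔉meet∖𝔉blocker1 = ⊆ , ⊇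
      where
      𝔉meet⇔ : ∀ K {x} → let j = + suc K ℤ.- 1ℤ ; j′ = ν (r ℚ.* toℚ (suc K)) ℤ.- 1ℤ in
        𝔉P P (_∧▽_ P (blocker1 P ω j) (blocker P ω j′ A)) x ⇔
        (𝔉P P (blocker1 P ω j) x × 𝔉P P (blocker P ω j′ A) x)
      𝔉meet⇔ K = 𝔉P-∧▽⇔ λ z →
        𝔉blocker? ⁅ top ⁆ (ℤ.i≤j⇒0≤j-i (+≤+ (s≤s z≤n))) z ×-dec
        𝔉blocker? A (ℤ.i≤j⇒0≤j-i (ν-positive r K 0≤r)) z
      ⊆ : ∀ {x} → ⋃level∩𝔉blocker x → ⋃𝔉meet∖𝔉blocker1 x
      ⊆ (suc K , bounds , (above , ¬above′) , x∈𝔉) =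
        suc K , bounds , from (𝔉meet⇔ K) (above , x∈𝔉) , ¬above′
      ⊇ : ∀ {x} → ⋃𝔉meet∖𝔉blocker1 x → ⋃level∩𝔉blocker x
      ⊇ (suc K , bounds , x∈𝔉meet , ¬above′) = let above , x∈𝔉 = to (𝔉meet⇔ K) x∈𝔉meet in
        suc K , bounds , (above , ¬above′) , x∈𝔉

rankMap-⊥ : ∀ {m} (ρ : Fin m → ℕ) → rankMap ρ ⊥ ≡ -1ℤ
rankMap-⊥ {zero}  ρ = refl
rankMap-⊥ {suc m} ρ = rankMap-⊥ (ρ ∘ Fin.suc)

rankMap-⁅⁆ : ∀ {m} (ρ : Fin m → ℕ) x → rankMap ρ ⁅ x ⁆ ≡ + ρ x
rankMap-⁅⁆ ρ Fin.zero    rewrite rankMap-⊥ (ρ ∘ Fin.suc) = refl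
rankMap-⁅⁆ ρ (Fin.suc x) = rankMap-⁅⁆ (ρ ∘ Fin.suc) x

rankMap-≥-member : ∀ {m} (ρ : Fin m → ℕ) {B x} → x ∈ B → + ρ x ℤ.≤ rankMap ρ B
rankMap-≥-member ρ {true ∷ B} here = ℤ.i≤i⊔j (+ ρ Fin.zero) (rankMap (ρ ∘ Fin.suc) B)
rankMap-≥-member ρ {true ∷ B} (there x∈B) =
  ℤ.≤-trans (rankMap-≥-member (ρ ∘ Fin.suc) x∈B) (ℤ.i≤j⊔i (+ ρ Fin.zero) _)
rankMap-≥-member ρ {false ∷ B} (there x∈B) = rankMap-≥-member (ρ ∘ Fin.suc) x∈B

rankMap-attained : ∀ {m} (ρ : Fin m → ℕ) B →
                   rankMap ρ B ≡ -1ℤ ⊎ ∃ λ b → b ∈ B × rankMap ρ B ≡ + ρ b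
rankMap-attained ρ [] = inj₁ refl
rankMap-attained ρ (true ∷ B) with ℤ.⊔-sel (+ ρ Fin.zero) (rankMap (ρ ∘ Fin.suc) B)
                                 | rankMap-attained (ρ ∘ Fin.suc) B
... | inj₁ ≡head | _ = inj₂ (Fin.zero , here , ≡head)
... | inj₂ ≡tail | inj₁ ≡-1 = inj₁ (trans ≡tail ≡-1)
... | inj₂ ≡tail | inj₂ (b , b∈B , ≡ρb) = inj₂ (Fin.suc b , there b∈B , trans ≡tail ≡ρb)
rankMap-attained ρ (false ∷ B) with rankMap-attained (ρ ∘ Fin.suc) B
... | inj₁ ≡-1 = inj₁ ≡-1
... | inj₂ (b , b∈B , ≡ρb) = inj₂ (Fin.suc b , there b∈B , ≡ρb)

-1≤rankMap : ∀ {m} (ρ : Fin m → ℕ) B → -1ℤ ℤ.≤ rankMap ρ B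
-1≤rankMap ρ B with rankMap-attained ρ B
... | inj₁ ≡-1 = ℤ.≤-reflexive (sym ≡-1)
... | inj₂ (_ , _ , ≡ρb) = ℤ.≤-trans ℤ.-≤+ (ℤ.≤-reflexive (sym ≡ρb))

module RankProperties {n : ℕ} {P : FinBoundedPoset n} {ρ : Fin n → ℕ}
                      (isRank : IsRankFunction P ρ) where
  open FinBoundedPoset P
  open PosetProperties P

  ρ-strictMono : ∀ {p q} → p < q → ρ p ℕ.< ρ q
  ρ-strictMono {q = q} = go q (<-wellFounded q)
    where
    go : ∀ q → Acc _<_ q → ∀ {p} → p < q → ρ p ℕ.< ρ q
    go q (acc rec) {p} p<q with maximal-above (λ z → (p ≤? z) ×-dec (z <? q)) (≤-refl , p<q)
    ... | z , ((p≤z , z<q) , z-max) , _ = subst (ρ p ℕ.<_) (sym ρq≡1+ρz) (s≤s ρp≤ρz)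
      where
      -- z is maximal in [p, q), so q covers z
      z⋖q : _⋖_ P z q
      z⋖q = z<q , λ w (z<w , w<q) → z-max w (≤-trans p≤z (<⇒≤ z<w) , w<q) z<w
      ρq≡1+ρz : ρ q ≡ suc (ρ z)
      ρq≡1+ρz = proj₂ isRank z q z⋖q
      ρp≤ρz : ρ p ℕ.≤ ρ z
      ρp≤ρz with p ≟ z
      ... | yes refl = ℕ.≤-refl
      ... | no p≢z = ℕ.<⇒≤ (go z (rec z<q) (p≤z , p≢z))

  ρ-mono : ∀ {p q} → p ≤ q → ρ p ℕ.≤ ρ q
  ρ-mono {p} {q} p≤q with p ≟ q
  ... | yes refl = ℕ.≤-refl
  ... | no p≢q = ℕ.<⇒≤ (ρ-strictMono (p≤q , p≢q))

  rankMap-mono : ∀ A B → _≤△_ P A B → rankMap ρ A ℤ.≤ rankMap ρ B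
  rankMap-mono A B A≤B with rankMap-attained ρ A
  ... | inj₁ ≡-1 = ℤ.≤-trans (ℤ.≤-reflexive ≡-1) (-1≤rankMap ρ B)
  ... | inj₂ (a , a∈A , ≡ρa) =
    let b , b∈B , a≤b = to (∈𝔍⇔ B) (A≤B (from (∈𝔍⇔ A) (a , a∈A , ≤-refl))) in
    ℤ.≤-trans (ℤ.≤-reflexive ≡ρa) (ℤ.≤-trans (+≤+ (ρ-mono a≤b)) (rankMap-≥-member ρ b∈B))

  rankMap-admissible : Admissible P (rankMap ρ)
  rankMap-admissible = record
    { range = λ A _ → -1≤rankMap ρ A
    ; empty = rankMap-⊥ ρ
    ; zerô  = trans (rankMap-⁅⁆ ρ bot) (cong +_ (proj₁ isRank))
    ; mono  = λ A B A-antichain _ ⁅bot⁆≤A A≢⁅bot⁆ A≤B →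
                0<rankMap A A-antichain ⁅bot⁆≤A A≢⁅bot⁆ , rankMap-mono A B A≤B
    }
    where
    0<rankMap : ∀ A → IsAntichain P A → _≤△_ P ⁅ bot ⁆ A → A ≢ ⁅ bot ⁆ → 0ℤ ℤ.< rankMap ρ A
    0<rankMap A A-antichain ⁅bot⁆≤A A≢⁅bot⁆ =
      ℤ.<-≤-trans (+<+ (subst (ℕ._< ρ a) (proj₁ isRank) (ρ-strictMono (bot-least a , a≢bot ∘ sym))))
                  (rankMap-≥-member ρ a∈A)
      where
      a∈A,bot≤a : ∃ λ a → a ∈ A × bot ≤ a
      a∈A,bot≤a = to (∈𝔍⇔ A) (⁅bot⁆≤A (from (∈𝔍⁅⁆⇔ bot) ≤-refl))
      a = proj₁ a∈A,bot≤a
      a∈A = proj₁ (proj₂ a∈A,bot≤a)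
      a≢bot : a ≢ bot
      a≢bot a≡bot = A≢⁅bot⁆ (antichain∋bot⇒≡⁅bot⁆ A-antichain (subst (_∈ A) a≡bot a∈A))

  rankMap-∧△-≤ : ∀ x a → rankMap ρ (_∧△_ P ⁅ x ⁆ ⁅ a ⁆) ℤ.≤ + ρ a
  rankMap-∧△-≤ x a = ℤ.≤-trans (rankMap-mono (_∧△_ P ⁅ x ⁆ ⁅ a ⁆) ⁅ a ⁆ (∧△-≤△ʳ ⁅ x ⁆ ⁅ a ⁆))
                               (ℤ.≤-reflexive (rankMap-⁅⁆ ρ a))

  module _ {r : ℚ} (0≤r : 0ℚ ℚ.≤ r) (A : Subset n) where
    open AdmissibleProperties rankMap-admissible using (∈𝐈⇔; ∈𝔉blocker-ν⇔)

    ⋃rank∩𝔉blocker : Pred (Fin n) 0ℓ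
    ⋃rank∩𝔉blocker x = Σ ℕ λ k → (1 ℕ.≤ k × k ℕ.≤ ρ top) ×
      (∀ a → a ∈ A → ν (r ℚ.* toℚ k) ℤ.≤ + ρ a) × ρ x ≡ k ×
      𝔉P P (blocker P (rankMap ρ) (ν (r ℚ.* toℚ k) ℤ.- 1ℤ) A) x

    𝐈≐⋃rank∩𝔉blocker : 𝐈 P r A (rankMap ρ) ≐ ⋃rank∩𝔉blocker
    𝐈≐⋃rank∩𝔉blocker = ⊆ , ⊇
      where
      ⊆ : ∀ {x} → 𝐈 P r A (rankMap ρ) x → ⋃rank∩𝔉blocker x
      ⊆ {x} x∈𝐈 = let K , ωx≡ , ν≤ = to (∈𝐈⇔ 0≤r A) x∈𝐈
                      ρx≡ = ℤ.+-injective (trans (sym (rankMap-⁅⁆ ρ x)) ωx≡) in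
        suc K , (s≤s z≤n , subst (ℕ._≤ ρ top) ρx≡ (ρ-mono (top-greatest x))) ,
        (λ a a∈ → ℤ.≤-trans (ν≤ a a∈) (rankMap-∧△-≤ x a)) , ρx≡ ,
        from (∈𝔉blocker-ν⇔ 0≤r A K) ν≤
      ⊇ : ∀ {x} → ⋃rank∩𝔉blocker x → 𝐈 P r A (rankMap ρ) x
      ⊇ {x} (suc K , _ , _ , ρx≡ , x∈𝔉) =
        from (∈𝐈⇔ 0≤r A) (K , trans (rankMap-⁅⁆ ρ x) (cong +_ ρx≡) , to (∈𝔉blocker-ν⇔ 0≤r A K) x∈𝔉)

proposition5p1 : (n : ℕ) (P : FinBoundedPoset n) → 2 ℕ.≤ n →
  (r : ℚ) → 0ℚ ℚ.≤ r → r ℚ.< 1ℚ →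
  (A : Subset n) → NontrivialAntichain P A →
  -- (i)
  ((ω : Subset n → ℤ) → Admissible P ω →
    let ωP = ω ⁅ FinBoundedPoset.top P ⁆
        b = blocker P ω
        b1 = blocker1 P ω
        F = 𝔉P P
    in (𝐈 P r A ω ≐ (λ x → Σ ℕ λ k → (1 ℕ.≤ k × + k ℤ.≤ ωP) ×
               ((F (b1 (+ k ℤ.- 1ℤ)) x × ¬ F (b1 (+ k)) x) ×
                F (b (ν (r ℚ.* toℚ k) ℤ.- 1ℤ) A) x)))
     × (𝐈 P r A ω ≐ (λ x → Σ ℕ λ k → (1 ℕ.≤ k × + k ℤ.≤ ωP) ×
               (F (_∧▽_ P (b1 (+ k ℤ.- 1ℤ)) (b (ν (r ℚ.* toℚ k) ℤ.- 1ℤ) A)) x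
                × ¬ F (b1 (+ k)) x))))
  ×
  -- (ii)
  ((ρ : Fin n → ℕ) → IsRankFunction P ρ →
    𝐈 P r A (rankMap ρ) ≐ (λ x → Σ ℕ λ k →
        (1 ℕ.≤ k × k ℕ.≤ ρ (FinBoundedPoset.top P)) ×
        (∀ a → a ∈ A → ν (r ℚ.* toℚ k) ℤ.≤ + ρ a) ×
        ρ x ≡ k ×
        𝔉P P (blocker P (rankMap ρ) (ν (r ℚ.* toℚ k) ℤ.- 1ℤ) A) x))
proposition5p1 n P _ r 0≤r _ A _ =
  (λ ω adm → let open AdmissibleProperties adm in
    𝐈≐⋃level∩𝔉blocker 0≤r A ,
    ≐-trans (𝐈≐⋃level∩𝔉blocker 0≤r A) (⋃level∩𝔉blocker≐⋃𝔉meet∖𝔉blocker1 0≤r A)) ,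
  (λ ρ isRank → RankProperties.𝐈≐⋃rank∩𝔉blocker {P = P} {ρ} isRank 0≤r A)
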